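{- For every number of variables $n\ge 2$ and every even degree $d\ge 2$ there exists a homogeneous non-commutative polynomial $f$ of degree $d$ in the variables $x_1,\dots,x_n$, with nonnegative real coefficients, whose monotone ABP complexity is $B^+(f)=\Omega(d^2\log n)$ and whose (non-monotone) ABP complexity is $B(f)=O(d^2)$. (The constants implicit in $\Omega$ and $O$ are absolute, independent of $n$ and $d$.)
   Context: We work with non-commutative polynomials: a homogeneous polynomial of degree $d$ in $n$ variables is $f=\sum_{i_1,\dots,i_d\in[n]} c_{i_1\cdots i_d}\,x_{i_1}x_{i_2}\cdots x_{i_d}$, where the variables do not commute, so each of the $n^d$ ordered words $x_{i_1}\cdots x_{i_d}$ has its own coefficient. An algebraic branching program (ABP) of degree $d$ is a directed acyclic graph whose vertices are partitioned into levels $0,1,\dots,d$, with a single vertex (the source) at level $0$, a single vertex (the sink) at level $d$, and edges only from level $i$ to level $i+1$; each edge is labelled by a homogeneous linear form $\sum_i c_i x_i$ with real coefficients. The ABP computes the sum, over all source-to-sink paths, of the ordered (non-commutative) product of the edge labels along the path. The size of an ABP is its number of vertices. $B(f)$ is the minimum size of an ABP computing $f$. An ABP is monotone if all coefficients used in its edge labels are positive; $B^+(f)$ is the minimum size of a monotone ABP computing $f$. Logarithms are base 2. -}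

module Defs where

open import Level using (0ℓ)
open import Data.Nat using (ℕ; zero; suc)
import Data.Nat as ℕ
open import Data.Fin using (Fin; zero; suc)
open import Data.Vec using (Vec; []; _∷_)
open import Data.Product using (Σ; ∃; _×_; _,_)
open import Data.Sum using (_⊎_)
open import Relation.Binary.PropositionalEquality using (_≡_; _≢_)
open import Data.Unit using (⊤)
import Algebra.Structures as AS
import Relation.Binary.Structures as RS

-- The real numbers, axiomatised as a Dedekind-complete ordered field
-- (unique up to isomorphism), since agda-stdlib has no real numbers.

record RealField : Set₁ where
  infixl 6 _+_
  infixl 7 _*_
  infix  4 _<_ _≤_
  field
    Carrier : Set
    _+_ _*_ : Carrier → Carrier → Carrier
    -_      : Carrier → Carrier
    0# 1#   : Carrier
    _<_     : Carrier → Carrier → Set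
    isCommutativeRing : AS.IsCommutativeRing {A = Carrier} _≡_ _+_ _*_ -_ 0# 1#
    0≢1     : 0# ≢ 1#
    inverse : ∀ x → x ≢ 0# → ∃ λ y → x * y ≡ 1#
    isStrictTotalOrder : RS.IsStrictTotalOrder {A = Carrier} _≡_ _<_
    +-mono-< : ∀ x y z → x < y → x + z < y + z
    *-pos    : ∀ x y → 0# < x → 0# < y → 0# < x * y

  _≤_ : Carrier → Carrier → Set
  x ≤ y = x < y ⊎ x ≡ y

  field
    complete : (P : Carrier → Set) → ∃ P → (∃ λ b → ∀ x → P x → x ≤ b) →
               ∃ λ s → (∀ x → P x → x ≤ s) × (∀ b → (∀ x → P x → x ≤ b) → s ≤ b)

module _ (ℝ : RealField) where
  open RealField ℝ

  sumFin : ∀ {w} → (Fin w → Carrier) → Carrier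
  sumFin {zero}  g = 0#
  sumFin {suc w} g = g zero + sumFin (λ i → g (suc i))

  -- A homogeneous non-commutative polynomial of degree d in n variables:
  -- one coefficient for each ordered word x_{i₁} ⋯ x_{i_d}.
  Poly : ℕ → ℕ → Set
  Poly n d = Vec (Fin n) d → Carrier

  LinForm : ℕ → Set
  LinForm n = Fin n → Carrier

  -- Layered graph: starting at a level with w vertices, followed by d more
  -- levels, the last of which has exactly one vertex (the sink).
  -- Between consecutive levels, lab u v is the linear form on the edge u → v
  -- (the zero form encodes "no edge").
  data Layers (n : ℕ) : ℕ → ℕ → Set where
    sink : Layers n 1 0
    step : ∀ {w d} (w' : ℕ) (lab : Fin w → Fin w' → LinForm n) →
           Layers n w' d → Layers n w (suc d)

  ABP : ℕ → ℕ → Set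
  ABP n d = Layers n 1 d

  sizeL : ∀ {n w d} → Layers n w d → ℕ
  sizeL {w = w} sink           = 1
  sizeL {w = w} (step _ _ L)   = w ℕ.+ sizeL L

  size : ∀ {n d} → ABP n d → ℕ
  size = sizeL

  MonotoneL : ∀ {n w d} → Layers n w d → Set
  MonotoneL sink           = ⊤
  MonotoneL (step _ lab L) = (∀ u v j → 0# ≤ lab u v j) × MonotoneL L

  Monotone : ∀ {n d} → ABP n d → Set
  Monotone = MonotoneL

  -- pathSumL L acc word: acc u is the sum, over all paths from the source to
  -- vertex u of the current level, of the product of the coefficients (read
  -- off according to the word) along the path.  Returns the same sum for
  -- paths from the source to the sink.
  pathSumL : ∀ {n w d} → Layers n w d → (Fin w → Carrier) → Vec (Fin n) d → Carrier
  pathSumL sink           acc []      = acc zero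
  pathSumL (step w' lab L) acc (j ∷ ws) =
    pathSumL L (λ v → sumFin (λ u → acc u * lab u v j)) ws

  computed : ∀ {n d} → ABP n d → Poly n d
  computed A word = pathSumL A (λ _ → 1#) word

  Computes : ∀ {n d} → ABP n d → Poly n d → Set
  Computes A f = ∀ word → computed A word ≡ f word

-- The polynomial is f(w) = Σ_{a<M} (w_a − w_{M+a})² on words of length d = 2M, the letter x_j
-- read as the number j.  Expanding the squares writes f as a sum of 4M products with one linear
-- form per position, i.e. 4M parallel chains: an ABP with O(d²) vertices.
-- A monotone ABP cannot cancel.  Cut it after level t ≤ M and feed it the words i 0ᵖ j 0ᵖ with
-- |i| = |j| = t and t + p = M.  Then f vanishes iff i = j, so if the level-t vertices reached with
-- positive weight by the prefix i were among those reached by j, then f(i 0ᵖ j 0ᵖ) > 0 would force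
-- f(j 0ᵖ j 0ᵖ) > 0.  Hence the n^t prefixes have distinct supports, level t has at least t log n
-- vertices, and summing over t ≤ M gives size ≥ M² log n / 2 = d² log n / 8.

module Submission where

open import Level using (0ℓ)
open import Defs
open import Algebra.Bundles using (CommutativeRing)
open import Data.Fin using (Fin; zero; suc; toℕ; combine; remQuot; funToFin; finToFun; _↑ˡ_; _↑ʳ_)
import Data.Fin.Properties as Finₚ
open import Data.Nat using (ℕ; zero; suc; z≤n; s≤s; NonZero)
import Data.Nat as Nat
import Data.Nat.Properties as ℕₚ
open import Data.Nat.Divisibility using (_∣_; divides)
open import Data.Nat.Tactic.RingSolver using (solve-∀)
open import Data.Product using (∃; _×_; _,_)
open import Data.Sum using (_⊎_; inj₁; inj₂)
open import Data.Vec using (Vec; []; _∷_; _++_; replicate; tabulate; lookup)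
import Data.Vec.Properties as Vecₚ
open import Function using (_∘_; id)
open import Relation.Binary.Definitions using (tri<; tri≈; tri>)
open import Relation.Binary.PropositionalEquality
open import Relation.Binary.Structures using (IsStrictTotalOrder)
open import Relation.Nullary using (¬_; yes; no; contradiction)
open import Relation.Unary using (Pred; _⊆_)

module _ where
  open Nat using (_+_; _*_; _^_; _≤_)

  funToFin-cong : ∀ {m l} {f g : Fin m → Fin l} → f ≗ g → funToFin f ≡ funToFin g
  funToFin-cong {zero}  _   = refl
  funToFin-cong {suc m} f≗g = cong₂ combine (f≗g zero) (funToFin-cong (f≗g ∘ suc))

  injective⇒^≤ : ∀ {m k l W} (S : Vec (Fin m) k → Fin W → Fin l) →
                 (∀ {u v} → S u ≗ S v → u ≡ v) → m ^ k ≤ l ^ W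
  injective⇒^≤ {m} {k} {l} {W} S S-injective = Finₚ.injective⇒≤ code-injective
    where
      open ≡-Reasoning

      letters : Fin (m ^ k) → Fin k → Fin m
      letters = finToFun

      word : Fin (m ^ k) → Vec (Fin m) k
      word c = tabulate (letters c)

      code : Fin (m ^ k) → Fin (l ^ W)
      code c = funToFin (S (word c))

      code-injective : ∀ {c c′} → code c ≡ code c′ → c ≡ c′
      code-injective {c} {c′} code≡ = begin
          c                       ≡⟨ Finₚ.funToFin-finToFin {k} {m} c ⟨
          funToFin (letters c)    ≡⟨ funToFin-cong same-letters ⟩
          funToFin (letters c′)   ≡⟨ Finₚ.funToFin-finToFin {k} {m} c′ ⟩
          c′                      ∎
        where
          same-image : S (word c) ≗ S (word c′)
          same-image x = begin
            S (word c) x              ≡⟨ Finₚ.finToFun-funToFin (S (word c)) x ⟨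
            finToFun (code c) x       ≡⟨ cong (λ e → finToFun e x) code≡ ⟩
            finToFun (code c′) x      ≡⟨ Finₚ.finToFun-funToFin (S (word c′)) x ⟩
            S (word c′) x             ∎

          same-letters : letters c ≗ letters c′
          same-letters i = begin
            letters c i               ≡⟨ Vecₚ.lookup∘tabulate (letters c) i ⟨
            lookup (word c) i         ≡⟨ cong (λ v → lookup v i) (S-injective same-image) ⟩
            lookup (word c′) i        ≡⟨ Vecₚ.lookup∘tabulate (letters c′) i ⟩
            letters c′ i              ∎

  sumUpTo : ℕ → (ℕ → ℕ) → ℕ
  sumUpTo zero    g = g 0
  sumUpTo (suc m) g = g 0 + sumUpTo m (g ∘ suc)

  sumUpTo-mono-≤ : ∀ g {m D} → m ≤ D → sumUpTo m g ≤ sumUpTo D g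
  sumUpTo-mono-≤ g {zero}  {zero}  _         = ℕₚ.≤-refl
  sumUpTo-mono-≤ g {zero}  {suc D} _         = ℕₚ.m≤m+n (g 0) _
  sumUpTo-mono-≤ g {suc m} {suc D} (s≤s m≤D) =
    ℕₚ.+-monoʳ-≤ (g 0) (sumUpTo-mono-≤ (g ∘ suc) m≤D)

  ^-sumUpTo-mono-≤ : ∀ b c m (e g : ℕ → ℕ) → (∀ t → t ≤ m → b ^ e t ≤ c ^ g t) →
                     b ^ sumUpTo m e ≤ c ^ sumUpTo m g
  ^-sumUpTo-mono-≤ b c zero    e g bound = bound 0 z≤n
  ^-sumUpTo-mono-≤ b c (suc m) e g bound = begin
      b ^ (e 0 + sumUpTo m (e ∘ suc))     ≡⟨ ℕₚ.^-distribˡ-+-* b (e 0) _ ⟩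
      b ^ e 0 * b ^ sumUpTo m (e ∘ suc)   ≤⟨ ℕₚ.*-mono-≤ (bound 0 z≤n) rest ⟩
      c ^ g 0 * c ^ sumUpTo m (g ∘ suc)   ≡⟨ ℕₚ.^-distribˡ-+-* c (g 0) _ ⟨
      c ^ (g 0 + sumUpTo m (g ∘ suc))     ∎
    where
      open ℕₚ.≤-Reasoning
      rest = ^-sumUpTo-mono-≤ b c m (e ∘ suc) (g ∘ suc) (λ t t≤m → bound (suc t) (s≤s t≤m))

  sumUpTo-suc : ∀ m g → sumUpTo m (suc ∘ g) ≡ suc m + sumUpTo m g
  sumUpTo-suc zero    g = refl
  sumUpTo-suc (suc m) g = trans (cong (suc (g 0) +_) (sumUpTo-suc m (g ∘ suc))) (swap (g 0) m _)
    where
      swap : ∀ a m s → suc a + (suc m + s) ≡ suc (suc m) + (a + s)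
      swap = solve-∀

  triangular : ℕ → ℕ
  triangular m = sumUpTo m id

  double-triangular : ∀ m → 2 * triangular m ≡ m * suc m
  double-triangular zero    = refl
  double-triangular (suc m) = begin
      2 * sumUpTo m suc              ≡⟨ cong (2 *_) (sumUpTo-suc m id) ⟩
      2 * (suc m + triangular m)     ≡⟨ ℕₚ.*-distribˡ-+ 2 (suc m) _ ⟩
      2 * suc m + 2 * triangular m   ≡⟨ cong (2 * suc m +_) (double-triangular m) ⟩
      2 * suc m + m * suc m          ≡⟨ expand m ⟩
      suc m * suc (suc m)            ∎
    where
      open ≡-Reasoning
      expand : ∀ m → 2 * suc m + m * suc m ≡ suc m * suc (suc m)
      expand = solve-∀

  square≤8*triangular : ∀ M → (M * 2) * (M * 2) ≤ 8 * triangular M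
  square≤8*triangular M = begin
      (M * 2) * (M * 2)             ≤⟨ ℕₚ.m≤m+n _ (4 * M) ⟩
      (M * 2) * (M * 2) + 4 * M     ≡⟨ expand M ⟩
      4 * (M * suc M)               ≡⟨ cong (4 *_) (double-triangular M) ⟨
      4 * (2 * triangular M)        ≡⟨ ℕₚ.*-assoc 4 2 (triangular M) ⟨
      8 * triangular M              ∎
    where
      open ℕₚ.≤-Reasoning
      expand : ∀ M → (M * 2) * (M * 2) + 4 * M ≡ 4 * (M * suc M)
      expand = solve-∀

  levelBounds⇒^≤ : ∀ n .{{_ : NonZero n}} M (W : ℕ → ℕ) →
                   (∀ t → t ≤ M → n ^ t ≤ 2 ^ W t) →
                   n ^ ((M * 2) * (M * 2)) ≤ 2 ^ (8 * sumUpTo M W)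
  levelBounds⇒^≤ n M W bounds = begin
      n ^ ((M * 2) * (M * 2))   ≤⟨ ℕₚ.^-monoʳ-≤ n (square≤8*triangular M) ⟩
      n ^ (8 * T)               ≡⟨ cong (n ^_) (ℕₚ.*-comm 8 T) ⟩
      n ^ (T * 8)               ≡⟨ ℕₚ.^-*-assoc n T 8 ⟨
      (n ^ T) ^ 8               ≤⟨ ℕₚ.^-monoˡ-≤ 8 (^-sumUpTo-mono-≤ n 2 M id W bounds) ⟩
      (2 ^ S) ^ 8               ≡⟨ ℕₚ.^-*-assoc 2 S 8 ⟩
      2 ^ (S * 8)               ≡⟨ cong (2 ^_) (ℕₚ.*-comm S 8) ⟩
      2 ^ (8 * S)               ∎
    where
      open ℕₚ.≤-Reasoning
      T = triangular M
      S = sumUpTo M W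

module _ (ℝ : RealField) where
  open RealField ℝ

  commutativeRing : CommutativeRing 0ℓ 0ℓ
  commutativeRing = record { isCommutativeRing = isCommutativeRing }

  open CommutativeRing commutativeRing
    using ( +-assoc; +-comm; +-identityˡ; +-identityʳ; *-identityˡ; *-identityʳ; *-assoc
          ; distribˡ; distribʳ; zeroˡ; zeroʳ; -‿inverseʳ; _-_
          ; ring; +-rawMonoid; *-commutativeSemigroup )
  open import Algebra.Properties.Ring ring
    using (-‿distribˡ-*; -‿distribʳ-*; -‿involutive; x∙y⁻¹≈ε⇒x≈y)
  open import Algebra.Properties.CommutativeSemigroup *-commutativeSemigroup
    using (interchange; x∙yz≈y∙xz)
  open import Algebra.Definitions.RawMonoid +-rawMonoid using () renaming (_×_ to _×ₙ_)
  open IsStrictTotalOrder isStrictTotalOrder using (compare; irrefl; _<?_; _≟_) renaming (trans to <-trans)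

  infix 10 _²
  _² : Carrier → Carrier
  x ² = x * x

  <-irrefl : ∀ {x} → ¬ x < x
  <-irrefl = irrefl refl

  ≤-<-trans : ∀ {x y z} → x ≤ y → y < z → x < z
  ≤-<-trans (inj₁ x<y)  y<z = <-trans x<y y<z
  ≤-<-trans (inj₂ refl) y<z = y<z

  x<0⇒0<-x : ∀ {x} → x < 0# → 0# < - x
  x<0⇒0<-x {x} x<0 = subst₂ _<_ (-‿inverseʳ x) (+-identityˡ (- x)) (+-mono-< x 0# (- x) x<0)

  -x²≡x² : ∀ x → (- x) ² ≡ x ²
  -x²≡x² x = begin
      - x * - x       ≡⟨ -‿distribˡ-* x (- x) ⟨
      - (x * - x)     ≡⟨ cong -_ (-‿distribʳ-* x x) ⟨
      - - (x * x)     ≡⟨ -‿involutive (x * x) ⟩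
      x * x           ∎
    where open ≡-Reasoning

  x≢0⇒0<x² : ∀ {x} → x ≢ 0# → 0# < x ²
  x≢0⇒0<x² {x} x≢0 with compare 0# x
  ... | tri< 0<x _ _ = *-pos x x 0<x 0<x
  ... | tri≈ _ 0≡x _ = contradiction (sym 0≡x) x≢0
  ... | tri> _ _ x<0 = subst (0# <_) (-x²≡x² x) (*-pos _ _ (x<0⇒0<-x x<0) (x<0⇒0<-x x<0))

  0≤x² : ∀ x → 0# ≤ x ²
  0≤x² x with x ≟ 0#
  ... | yes refl = inj₂ (sym (zeroˡ 0#))
  ... | no  x≢0  = inj₁ (x≢0⇒0<x² x≢0)

  0<1 : 0# < 1#
  0<1 = subst (0# <_) (*-identityˡ 1#) (x≢0⇒0<x² (0≢1 ∘ sym))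

  0<+ˡ : ∀ {x y} → 0# < x → 0# ≤ y → 0# < x + y
  0<+ˡ {x} {y} 0<x 0≤y = ≤-<-trans (subst (0# ≤_) (sym (+-identityˡ y)) 0≤y) (+-mono-< 0# x y 0<x)

  0<+ʳ : ∀ {x y} → 0# ≤ x → 0# < y → 0# < x + y
  0<+ʳ {x} {y} 0≤x 0<y = subst (0# <_) (+-comm y x) (0<+ˡ 0<y 0≤x)

  0≤+ : ∀ {x y} → 0# ≤ x → 0# ≤ y → 0# ≤ x + y
  0≤+         (inj₁ 0<x)  0≤y = inj₁ (0<+ˡ 0<x 0≤y)
  0≤+ {y = y} (inj₂ refl) 0≤y = subst (0# ≤_) (sym (+-identityˡ y)) 0≤y

  0≤* : ∀ {x y} → 0# ≤ x → 0# ≤ y → 0# ≤ x * y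
  0≤*         (inj₁ 0<x)  (inj₁ 0<y)  = inj₁ (*-pos _ _ 0<x 0<y)
  0≤* {x}     (inj₁ _)    (inj₂ refl) = inj₂ (sym (zeroʳ x))
  0≤* {y = y} (inj₂ refl) _           = inj₂ (sym (zeroˡ y))

  0<+⇒ : ∀ {x y} → 0# ≤ x → 0# ≤ y → 0# < x + y → 0# < x ⊎ 0# < y
  0<+⇒         (inj₁ 0<x)  _ _     = inj₁ 0<x
  0<+⇒ {y = y} (inj₂ refl) _ 0<0+y = inj₂ (subst (0# <_) (+-identityˡ y) 0<0+y)

  0<*⇒ : ∀ {x y} → 0# ≤ x → 0# ≤ y → 0# < x * y → 0# < x × 0# < y
  0<*⇒         (inj₁ 0<x)  (inj₁ 0<y)  _     = 0<x , 0<y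
  0<*⇒ {x}     (inj₁ _)    (inj₂ refl) 0<x*0 = contradiction (subst (0# <_) (zeroʳ x) 0<x*0) <-irrefl
  0<*⇒ {y = y} (inj₂ refl) _           0<0*y = contradiction (subst (0# <_) (zeroˡ y) 0<0*y) <-irrefl

  ∑ : ∀ {w} → (Fin w → Carrier) → Carrier
  ∑ = sumFin ℝ

  ∑-cong : ∀ {w} {g h : Fin w → Carrier} → g ≗ h → ∑ g ≡ ∑ h
  ∑-cong {zero}  _   = refl
  ∑-cong {suc w} g≗h = cong₂ _+_ (g≗h zero) (∑-cong (g≗h ∘ suc))

  ∑-zero : ∀ w → ∑ {w} (λ _ → 0#) ≡ 0#
  ∑-zero zero    = refl
  ∑-zero (suc w) = trans (+-identityˡ _) (∑-zero w)

  ∑-↑ : ∀ m {N} (g : Fin (m Nat.+ N) → Carrier) →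
        ∑ g ≡ ∑ (λ i → g (i ↑ˡ N)) + ∑ (λ i → g (m ↑ʳ i))
  ∑-↑ zero    g = sym (+-identityˡ _)
  ∑-↑ (suc m) g = trans (cong (g zero +_) (∑-↑ m (g ∘ suc))) (sym (+-assoc _ _ _))

  ∑-combine : ∀ m {k} (g : Fin (m Nat.* k) → Carrier) →
              ∑ g ≡ ∑ (λ (i : Fin m) → ∑ (λ (j : Fin k) → g (combine i j)))
  ∑-combine zero        g = refl
  ∑-combine (suc m) {k} g =
    trans (∑-↑ k g)
          (cong (∑ (λ j → g (j ↑ˡ m Nat.* k)) +_) (∑-combine m (λ i → g (k ↑ʳ i))))

  0≤∑ : ∀ {w} {g : Fin w → Carrier} → (∀ u → 0# ≤ g u) → 0# ≤ ∑ g
  0≤∑ {zero}  _   = inj₂ refl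
  0≤∑ {suc w} 0≤g = 0≤+ (0≤g zero) (0≤∑ (0≤g ∘ suc))

  0<∑ : ∀ {w} {g : Fin w → Carrier} → (∀ u → 0# ≤ g u) → ∀ u → 0# < g u → 0# < ∑ g
  0<∑ 0≤g zero    0<gu = 0<+ˡ 0<gu (0≤∑ (0≤g ∘ suc))
  0<∑ 0≤g (suc u) 0<gu = 0<+ʳ (0≤g zero) (0<∑ (0≤g ∘ suc) u 0<gu)

  0<∑⇒ : ∀ {w} {g : Fin w → Carrier} → (∀ u → 0# ≤ g u) → 0# < ∑ g → ∃ λ u → 0# < g u
  0<∑⇒ {zero}  _   0<0  = contradiction 0<0 <-irrefl
  0<∑⇒ {suc w} 0≤g 0<∑g with 0<+⇒ (0≤g zero) (0≤∑ (0≤g ∘ suc)) 0<∑g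
  ... | inj₁ 0<g0   = zero , 0<g0
  ... | inj₂ 0<rest = let u , 0<gu = 0<∑⇒ (0≤g ∘ suc) 0<rest in suc u , 0<gu

  δ : ∀ {w} → Fin w → Fin w → Carrier
  δ zero    zero    = 1#
  δ zero    (suc _) = 0#
  δ (suc _) zero    = 0#
  δ (suc u) (suc v) = δ u v

  ∑-δ : ∀ {w} (g : Fin w → Carrier) v → ∑ (λ u → δ u v * g u) ≡ g v
  ∑-δ {suc w} g zero = begin
      1# * g zero + ∑ (λ u → 0# * g (suc u))   ≡⟨ cong₂ _+_ (*-identityˡ _) (∑-cong (zeroˡ ∘ g ∘ suc)) ⟩
      g zero + ∑ {w} (λ _ → 0#)                ≡⟨ cong (g zero +_) (∑-zero w) ⟩
      g zero + 0#                              ≡⟨ +-identityʳ _ ⟩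
      g zero                                   ∎
    where open ≡-Reasoning
  ∑-δ g (suc v)      = begin
      0# * g zero + ∑ (λ u → δ u v * g (suc u))   ≡⟨ cong₂ _+_ (zeroˡ _) (∑-δ (g ∘ suc) v) ⟩
      0# + g (suc v)                              ≡⟨ +-identityˡ _ ⟩
      g (suc v)                                   ∎
    where open ≡-Reasoning

  propagate : ∀ {n w w′} → (Fin w → Fin w′ → LinForm ℝ n) → Fin n →
              (Fin w → Carrier) → Fin w′ → Carrier
  propagate lab j acc v = ∑ (λ u → acc u * lab u v j)

  widthAt : ∀ {n w d} → ℕ → Layers ℝ n w d → ℕ
  widthAt {w = w} zero    _            = w
  widthAt         (suc t) sink         = 0
  widthAt         (suc t) (step _ _ L) = widthAt t L

  sizeL≡sumUpTo-widthAt : ∀ {n w d} (L : Layers ℝ n w d) →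
                          sizeL ℝ L ≡ sumUpTo d (λ t → widthAt t L)
  sizeL≡sumUpTo-widthAt         sink         = refl
  sizeL≡sumUpTo-widthAt {w = w} (step _ _ L) = cong (w Nat.+_) (sizeL≡sumUpTo-widthAt L)

  dropLayers : ∀ {n w} t {r} (L : Layers ℝ n w (t Nat.+ r)) → Layers ℝ n (widthAt t L) r
  dropLayers zero    L            = L
  dropLayers (suc t) (step _ _ L) = dropLayers t L

  -- the path sums, weighted by acc at the first level, into the vertices of level t
  forward : ∀ {n w} t {r} (L : Layers ℝ n w (t Nat.+ r)) →
            (Fin w → Carrier) → Vec (Fin n) t → Fin (widthAt t L) → Carrier
  forward zero    L              acc []        = acc
  forward (suc t) (step _ lab L) acc (j ∷ pre) = forward t L (propagate lab j acc) pre

  pathSumL-++ : ∀ {n w} t {r} (L : Layers ℝ n w (t Nat.+ r)) acc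
                (pre : Vec (Fin n) t) (suf : Vec (Fin n) r) →
                pathSumL ℝ L acc (pre ++ suf) ≡ pathSumL ℝ (dropLayers t L) (forward t L acc pre) suf
  pathSumL-++ zero    L              acc []        suf = refl
  pathSumL-++ (suc t) (step _ lab L) acc (j ∷ pre) suf = pathSumL-++ t L (propagate lab j acc) pre suf

  MonotoneL-drop : ∀ {n w} t {r} (L : Layers ℝ n w (t Nat.+ r)) →
                   MonotoneL ℝ L → MonotoneL ℝ (dropLayers t L)
  MonotoneL-drop zero    L            mono       = mono
  MonotoneL-drop (suc t) (step _ _ L) (_ , mono) = MonotoneL-drop t L mono

  Nonneg : ∀ {w} → (Fin w → Carrier) → Set
  Nonneg acc = ∀ v → 0# ≤ acc v

  positive : ∀ {w} → (Fin w → Carrier) → Pred (Fin w) 0ℓ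
  positive acc v = 0# < acc v

  NonnegLabels : ∀ {n w w′} → (Fin w → Fin w′ → LinForm ℝ n) → Set
  NonnegLabels lab = ∀ u v j → 0# ≤ lab u v j

  propagate-nonneg : ∀ {n w w′} {lab : Fin w → Fin w′ → LinForm ℝ n} {acc} → NonnegLabels lab →
                     ∀ j → Nonneg acc → Nonneg (propagate lab j acc)
  propagate-nonneg lab≥0 j acc≥0 v = 0≤∑ (λ u → 0≤* (acc≥0 u) (lab≥0 u v j))

  forward-nonneg : ∀ {n w} t {r} (L : Layers ℝ n w (t Nat.+ r)) → MonotoneL ℝ L →
                   ∀ {acc} → Nonneg acc → ∀ pre → Nonneg (forward t L acc pre)
  forward-nonneg zero    L            _              acc≥0 []        = acc≥0
  forward-nonneg (suc t) (step _ _ L) (lab≥0 , mono) acc≥0 (j ∷ pre) =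
    forward-nonneg t L mono (propagate-nonneg lab≥0 j acc≥0) pre

  propagate-⊆ : ∀ {n w w′} {lab : Fin w → Fin w′ → LinForm ℝ n} {a b} →
                NonnegLabels lab → Nonneg a → Nonneg b → positive a ⊆ positive b →
                ∀ j → positive (propagate lab j a) ⊆ positive (propagate lab j b)
  propagate-⊆ lab≥0 a≥0 b≥0 a⊆b j {v} 0<pa =
    let u , 0<au*l = 0<∑⇒ (λ u → 0≤* (a≥0 u) (lab≥0 u v j)) 0<pa
        0<au , 0<l = 0<*⇒ (a≥0 u) (lab≥0 u v j) 0<au*l
    in  0<∑ (λ u → 0≤* (b≥0 u) (lab≥0 u v j)) u (*-pos _ _ (a⊆b 0<au) 0<l)

  pathSumL-⊆ : ∀ {n w r} (L : Layers ℝ n w r) → MonotoneL ℝ L →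
               ∀ {a b} → Nonneg a → Nonneg b → positive a ⊆ positive b →
               ∀ s → 0# < pathSumL ℝ L a s → 0# < pathSumL ℝ L b s
  pathSumL-⊆ sink         _              _   _   a⊆b []      = a⊆b
  pathSumL-⊆ (step _ _ L) (lab≥0 , mono) a≥0 b≥0 a⊆b (j ∷ s) =
    pathSumL-⊆ L mono (propagate-nonneg lab≥0 j a≥0) (propagate-nonneg lab≥0 j b≥0)
      (propagate-⊆ lab≥0 a≥0 b≥0 a⊆b j) s

  -- Fooling sets for monotone ABPs

  positivity : Carrier → Fin 2
  positivity y with 0# <? y
  ... | yes _ = suc zero
  ... | no  _ = zero

  positivity-≡⇒ : ∀ {y z} → positivity y ≡ positivity z → 0# < y → 0# < z
  positivity-≡⇒ {y} {z} same 0<y with 0# <? y | 0# <? z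
  ... | _      | yes 0<z = 0<z
  ... | yes _  | no  _   = contradiction same λ ()
  ... | no 0≮y | no  _   = contradiction 0<y 0≮y

  -- (φ i, ψ i) is a fooling set for the cut after level t: the supports of the path sums into
  -- level t must then be pairwise distinct.
  foolingSet⇒^≤ : ∀ {n D k t r} (eq : t Nat.+ r ≡ D) {A : ABP ℝ n D} {f : Poly ℝ n D} →
                  Monotone ℝ A → Computes ℝ A f →
                  (φ : Vec (Fin n) k → Vec (Fin n) t) (ψ : Vec (Fin n) k → Vec (Fin n) r) →
                  (∀ i → f (subst (Vec (Fin n)) eq (φ i ++ ψ i)) ≡ 0#) →
                  (∀ i j → i ≢ j → 0# < f (subst (Vec (Fin n)) eq (φ i ++ ψ j))) →
                  n Nat.^ k Nat.≤ 2 Nat.^ widthAt t A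
  foolingSet⇒^≤ {n} {k = k} {t} refl {A} {f} mono computes φ ψ diagonal offDiagonal =
    injective⇒^≤ (λ i v → positivity (F i v)) λ same → supports-determine (positivity-≡⇒ (same _))
    where
      F : Vec (Fin n) k → Fin (widthAt t A) → Carrier
      F i = forward t A (λ _ → 1#) (φ i)

      F-nonneg : ∀ i → Nonneg (F i)
      F-nonneg i = forward-nonneg t A mono (λ _ → inj₁ 0<1) (φ i)

      f≡pathSum : ∀ i j → f (φ i ++ ψ j) ≡ pathSumL ℝ (dropLayers t A) (F i) (ψ j)
      f≡pathSum i j = trans (sym (computes (φ i ++ ψ j))) (pathSumL-++ t A (λ _ → 1#) (φ i) (ψ j))

      supports-determine : ∀ {i j} → positive (F i) ⊆ positive (F j) → i ≡ j
      supports-determine {i} {j} Fi⊆Fj with Vecₚ.≡-dec Finₚ._≟_ i j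
      ... | yes i≡j = i≡j
      ... | no  i≢j = contradiction (subst (0# <_) (diagonal j) 0<fjj) <-irrefl
        where
          0<fjj : 0# < f (φ j ++ ψ j)
          0<fjj = subst (0# <_) (sym (f≡pathSum j j))
            (pathSumL-⊆ (dropLayers t A) (MonotoneL-drop t A mono) (F-nonneg i) (F-nonneg j) Fi⊆Fj (ψ j)
              (subst (0# <_) (f≡pathSum i j) (offDiagonal i j i≢j)))

  -- Sums of products of linear forms

  wordProduct : ∀ {n k} → (ℕ → LinForm ℝ n) → Vec (Fin n) k → Carrier
  wordProduct h []      = 1#
  wordProduct h (j ∷ w) = h 0 j * wordProduct (h ∘ suc) w

  -- R vertex-disjoint chains (δ is the identity matrix), chain r carrying the forms h r 0, h r 1, …
  parallelLayers : ∀ {n R} k → (Fin R → ℕ → LinForm ℝ n) → Layers ℝ n R (suc k)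
  parallelLayers         zero    h = step 1 (λ r _ j → h r 0 j) sink
  parallelLayers {R = R} (suc k) h =
    step R (λ u v j → δ u v * h u 0 j) (parallelLayers k (λ r → h r ∘ suc))

  parallelLayers-pathSum : ∀ {n R} k h (acc : Fin R → Carrier) (w : Vec (Fin n) (suc k)) →
                           pathSumL ℝ (parallelLayers k h) acc w
                           ≡ ∑ (λ r → acc r * wordProduct (h r) w)
  parallelLayers-pathSum zero    h acc (j ∷ []) = ∑-cong (λ r → cong (acc r *_) (sym (*-identityʳ _)))
  parallelLayers-pathSum (suc k) h acc (j ∷ w) = begin
      pathSumL ℝ (parallelLayers k h′) (propagate lab j acc) w
    ≡⟨ parallelLayers-pathSum k h′ (propagate lab j acc) w ⟩
      ∑ (λ r → propagate lab j acc r * wordProduct (h′ r) w)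
    ≡⟨ ∑-cong (λ r → cong (_* wordProduct (h′ r) w) (propagate-δ r)) ⟩
      ∑ (λ r → (acc r * h r 0 j) * wordProduct (h′ r) w)
    ≡⟨ ∑-cong (λ r → *-assoc (acc r) _ _) ⟩
      ∑ (λ r → acc r * wordProduct (h r) (j ∷ w))
    ∎
    where
      open ≡-Reasoning
      h′ = λ r → h r ∘ suc
      lab = λ u v j → δ u v * h u 0 j
      propagate-δ : ∀ r → propagate lab j acc r ≡ acc r * h r 0 j
      propagate-δ r = trans (∑-cong (λ u → x∙yz≈y∙xz (acc u) (δ u r) (h u 0 j)))
                            (∑-δ (λ u → acc u * h u 0 j) r)

  parallelLayers-size : ∀ {n R} k (h : Fin R → ℕ → LinForm ℝ n) →
                        sizeL ℝ (parallelLayers k h) ≡ suc k Nat.* R Nat.+ 1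
  parallelLayers-size {R = R} zero    h = cong (Nat._+ 1) (sym (ℕₚ.+-identityʳ R))
  parallelLayers-size {R = R} (suc k) h =
    trans (cong (R Nat.+_) (parallelLayers-size k _)) (sym (ℕₚ.+-assoc R (suc k Nat.* R) 1))

  sumOfProducts : ∀ {n R} k → (Fin R → ℕ → LinForm ℝ n) → ABP ℝ n (suc (suc k))
  sumOfProducts {R = R} k h = step R (λ _ r j → h r 0 j) (parallelLayers k (λ r → h r ∘ suc))

  sumOfProducts-computes : ∀ {n R} k (h : Fin R → ℕ → LinForm ℝ n) w →
                           computed ℝ (sumOfProducts k h) w ≡ ∑ (λ r → wordProduct (h r) w)
  sumOfProducts-computes k h (j ∷ w) = trans (parallelLayers-pathSum k (λ r → h r ∘ suc) _ w)
    (∑-cong λ r → cong (_* wordProduct (h r ∘ suc) w) (trans (+-identityʳ _) (*-identityˡ (h r 0 j))))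

  sumOfProducts-size : ∀ {n R} k (h : Fin R → ℕ → LinForm ℝ n) →
                       size ℝ (sumOfProducts k h) ≡ suc (suc k Nat.* R Nat.+ 1)
  sumOfProducts-size k h = cong suc (parallelLayers-size k _)

  -- g of the a-th letter of w; past the end of w it is 1#, which makes wordProduct-onlyAt exact.
  valueAt : ∀ {n k} → ℕ → LinForm ℝ n → Vec (Fin n) k → Carrier
  valueAt _       _ []      = 1#
  valueAt zero    g (j ∷ _) = g j
  valueAt (suc a) g (_ ∷ w) = valueAt a g w

  valueAt-++ˡ : ∀ {n k l} (a : Fin k) g (u : Vec (Fin n) k) (v : Vec (Fin n) l) →
                valueAt (toℕ a) g (u ++ v) ≡ valueAt (toℕ a) g u
  valueAt-++ˡ zero    g (_ ∷ _) v = refl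
  valueAt-++ˡ (suc a) g (_ ∷ u) v = valueAt-++ˡ a g u v

  valueAt-++ʳ : ∀ {n k l} a g (u : Vec (Fin n) k) (v : Vec (Fin n) l) →
                valueAt (k Nat.+ a) g (u ++ v) ≡ valueAt a g v
  valueAt-++ʳ a g []      v = refl
  valueAt-++ʳ a g (_ ∷ u) v = valueAt-++ʳ a g u v

  valueAt-++-assoc : ∀ {n k l m} a g (u : Vec (Fin n) k) (v : Vec (Fin n) l) (w : Vec (Fin n) m) →
                     valueAt a g (u ++ (v ++ w)) ≡ valueAt a g ((u ++ v) ++ w)
  valueAt-++-assoc a       g []      v w = refl
  valueAt-++-assoc zero    g (_ ∷ u) v w = refl
  valueAt-++-assoc (suc a) g (_ ∷ u) v w = valueAt-++-assoc a g u v w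

  valueAt-subst : ∀ {n k l} (eq : k ≡ l) a g (w : Vec (Fin n) k) →
                  valueAt a g (subst (Vec (Fin n)) eq w) ≡ valueAt a g w
  valueAt-subst refl a g w = refl

  valueAt-∘- : ∀ {n k a} g (w : Vec (Fin n) k) → a Nat.< k → valueAt a (-_ ∘ g) w ≡ - valueAt a g w
  valueAt-∘- {a = zero}  g (_ ∷ _) _         = refl
  valueAt-∘- {a = suc a} g (_ ∷ w) (s≤s a<k) = valueAt-∘- g w a<k

  onlyAt : ∀ {n} → ℕ → LinForm ℝ n → ℕ → LinForm ℝ n
  onlyAt zero    g zero    = g
  onlyAt zero    _ (suc _) = λ _ → 1#
  onlyAt (suc _) _ zero    = λ _ → 1#
  onlyAt (suc a) g (suc s) = onlyAt a g s

  wordProduct-ones : ∀ {n k} (w : Vec (Fin n) k) → wordProduct (λ _ _ → 1#) w ≡ 1#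
  wordProduct-ones []      = refl
  wordProduct-ones (_ ∷ w) = trans (*-identityˡ _) (wordProduct-ones w)

  wordProduct-onlyAt : ∀ {n k} a g (w : Vec (Fin n) k) → wordProduct (onlyAt a g) w ≡ valueAt a g w
  wordProduct-onlyAt a       g []      = refl
  wordProduct-onlyAt zero    g (j ∷ w) = trans (cong (g j *_) (wordProduct-ones w)) (*-identityʳ (g j))
  wordProduct-onlyAt (suc a) g (_ ∷ w) = trans (*-identityˡ _) (wordProduct-onlyAt a g w)

  _⊙_ : ∀ {n} → (ℕ → LinForm ℝ n) → (ℕ → LinForm ℝ n) → ℕ → LinForm ℝ n
  (F ⊙ G) s j = F s j * G s j

  wordProduct-⊙ : ∀ {n k} F G (w : Vec (Fin n) k) →
                  wordProduct (F ⊙ G) w ≡ wordProduct F w * wordProduct G w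
  wordProduct-⊙ F G []      = sym (*-identityˡ 1#)
  wordProduct-⊙ F G (j ∷ w) =
    trans (cong (F 0 j * G 0 j *_) (wordProduct-⊙ (F ∘ suc) (G ∘ suc) w)) (interchange _ _ _ _)

  wordProduct-onlyAt² : ∀ {n k} a g b h (w : Vec (Fin n) k) →
                        wordProduct (onlyAt a g ⊙ onlyAt b h) w ≡ valueAt a g w * valueAt b h w
  wordProduct-onlyAt² a g b h w =
    trans (wordProduct-⊙ (onlyAt a g) (onlyAt b h) w)
          (cong₂ _*_ (wordProduct-onlyAt a g w) (wordProduct-onlyAt b h w))

  binomialChains : ∀ {n} → ℕ → LinForm ℝ n → ℕ → LinForm ℝ n → Fin 4 → ℕ → LinForm ℝ n
  binomialChains a g b h zero                   = onlyAt a g ⊙ onlyAt a g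
  binomialChains a g b h (suc zero)             = onlyAt a g ⊙ onlyAt b h
  binomialChains a g b h (suc (suc zero))       = onlyAt b h ⊙ onlyAt a g
  binomialChains a g b h (suc (suc (suc zero))) = onlyAt b h ⊙ onlyAt b h

  ∑-binomialChains : ∀ {n k} a g b h (w : Vec (Fin n) k) →
                     ∑ (λ c → wordProduct (binomialChains a g b h c) w)
                     ≡ (valueAt a g w + valueAt b h w) ²
  ∑-binomialChains a g b h w = begin
      ∑ (λ c → wordProduct (binomialChains a g b h c) w)
    ≡⟨ cong₂ _+_ (product a g a g) (cong₂ _+_ (product a g b h) (cong₂ _+_ (product b h a g)
         (trans (cong₂ _+_ (product b h b h) refl) (+-identityʳ _)))) ⟩
      p * p + (p * q + (q * p + q * q))
    ≡⟨ +-assoc (p * p) (p * q) _ ⟨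
      (p * p + p * q) + (q * p + q * q)
    ≡⟨ cong₂ _+_ (distribˡ p p q) (distribˡ q p q) ⟨
      p * (p + q) + q * (p + q)
    ≡⟨ distribʳ (p + q) p q ⟨
      (p + q) ²
    ∎
    where
      open ≡-Reasoning
      p = valueAt a g w
      q = valueAt b h w
      product = λ a g b h → wordProduct-onlyAt² a g b h w

  -- The separating polynomial

  ×ₙ1-<-suc : ∀ k → k ×ₙ 1# < suc k ×ₙ 1#
  ×ₙ1-<-suc k = subst (_< 1# + k ×ₙ 1#) (+-identityˡ (k ×ₙ 1#)) (+-mono-< 0# 1# (k ×ₙ 1#) 0<1)

  ×ₙ1-mono-< : ∀ {k l} → k Nat.< l → k ×ₙ 1# < l ×ₙ 1#
  ×ₙ1-mono-< {k} {suc l} (s≤s k≤l) with ℕₚ.m≤n⇒m<n∨m≡n k≤l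
  ... | inj₁ k<l  = <-trans (×ₙ1-mono-< k<l) (×ₙ1-<-suc l)
  ... | inj₂ refl = ×ₙ1-<-suc k

  ×ₙ1-injective : ∀ {k l} → k ×ₙ 1# ≡ l ×ₙ 1# → k ≡ l
  ×ₙ1-injective {k} {l} same with ℕₚ.<-cmp k l
  ... | tri< k<l _ _ = contradiction (subst (k ×ₙ 1# <_) (sym same) (×ₙ1-mono-< k<l)) <-irrefl
  ... | tri≈ _ k≡l _ = k≡l
  ... | tri> _ _ l<k = contradiction (subst (l ×ₙ 1# <_) same (×ₙ1-mono-< l<k)) <-irrefl

  letter : ∀ {n} → LinForm ℝ n
  letter j = toℕ j ×ₙ 1#

  letter-injective : ∀ {n} {i j : Fin n} → letter i ≡ letter j → i ≡ j
  letter-injective = Finₚ.toℕ-injective ∘ ×ₙ1-injective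

  valueAt-separates : ∀ {n k} {u v : Vec (Fin n) k} → u ≢ v →
                      ∃ λ (a : Fin k) → valueAt (toℕ a) letter u ≢ valueAt (toℕ a) letter v
  valueAt-separates {u = []}    {[]}    u≢v = contradiction refl u≢v
  valueAt-separates {u = i ∷ u} {j ∷ v} u≢v with i Finₚ.≟ j
  ... | no  i≢j  = zero , i≢j ∘ letter-injective
  ... | yes refl = let a , differ = valueAt-separates (u≢v ∘ cong (i ∷_)) in suc a , differ

  squaredDistance : ∀ {M} → (Fin M → Carrier) → (Fin M → Carrier) → Carrier
  squaredDistance x y = ∑ (λ a → (x a - y a) ²)

  squaredDistance-nonneg : ∀ {M} (x y : Fin M → Carrier) → 0# ≤ squaredDistance x y
  squaredDistance-nonneg x y = 0≤∑ (λ a → 0≤x² (x a - y a))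

  squaredDistance-cong : ∀ {M} {x x′ y y′ : Fin M → Carrier} → x ≗ x′ → y ≗ y′ →
                         squaredDistance x y ≡ squaredDistance x′ y′
  squaredDistance-cong x≗x′ y≗y′ = ∑-cong (λ a → cong₂ (λ p q → (p - q) ²) (x≗x′ a) (y≗y′ a))

  squaredDistance-self : ∀ {M} (x : Fin M → Carrier) → squaredDistance x x ≡ 0#
  squaredDistance-self {M} x = begin
      ∑ (λ a → (x a - x a) ²)   ≡⟨ ∑-cong (λ a → cong _² (-‿inverseʳ (x a))) ⟩
      ∑ {M} (λ _ → 0# ²)        ≡⟨ ∑-cong {M} (λ _ → zeroˡ 0#) ⟩
      ∑ {M} (λ _ → 0#)          ≡⟨ ∑-zero M ⟩
      0#                        ∎
    where open ≡-Reasoning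

  squaredDistance-pos : ∀ {M} (x y : Fin M → Carrier) a → x a ≢ y a → 0# < squaredDistance x y
  squaredDistance-pos x y a x≢y =
    0<∑ (λ a → 0≤x² (x a - y a)) a (x≢0⇒0<x² (x≢y ∘ x∙y⁻¹≈ε⇒x≈y (x a) (y a)))

  lettersFrom : ∀ {n k} M → ℕ → Vec (Fin n) k → Fin M → Carrier
  lettersFrom M s w a = valueAt (s Nat.+ toℕ a) letter w

  halvesDistance : ∀ {n k} → ℕ → Vec (Fin n) k → Carrier
  halvesDistance M w = squaredDistance (lettersFrom M 0 w) (lettersFrom M M w)

  halvesDistance-nonneg : ∀ {n k} M (w : Vec (Fin n) k) → 0# ≤ halvesDistance M w
  halvesDistance-nonneg M w = squaredDistance-nonneg (lettersFrom M 0 w) (lettersFrom M M w)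

  halvesDistance-cong : ∀ {n k l} M (w : Vec (Fin n) k) (w′ : Vec (Fin n) l) →
                        (∀ a → valueAt a letter w ≡ valueAt a letter w′) →
                        halvesDistance M w ≡ halvesDistance M w′
  halvesDistance-cong M w w′ same =
    squaredDistance-cong {M} (λ a → same (toℕ a)) (λ a → same (M Nat.+ toℕ a))

  halvesDistance-++ : ∀ {n M} (u v : Vec (Fin n) M) →
                      halvesDistance M (u ++ v) ≡ squaredDistance (lettersFrom M 0 u) (lettersFrom M 0 v)
  halvesDistance-++ {M = M} u v =
    squaredDistance-cong {M} (λ a → valueAt-++ˡ a letter u v) (λ a → valueAt-++ʳ (toℕ a) letter u v)

  halvesDistance-++-self : ∀ {n M} (u : Vec (Fin n) M) → halvesDistance M (u ++ u) ≡ 0#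
  halvesDistance-++-self {M = M} u = trans (halvesDistance-++ u u) (squaredDistance-self (lettersFrom M 0 u))

  halvesDistance-++-pos : ∀ {n M} {u v : Vec (Fin n) M} → u ≢ v → 0# < halvesDistance M (u ++ v)
  halvesDistance-++-pos {M = M} {u} {v} u≢v =
    let a , differ = valueAt-separates u≢v
    in  subst (0# <_) (sym (halvesDistance-++ u v))
              (squaredDistance-pos (lettersFrom M 0 u) (lettersFrom M 0 v) a differ)

  -- Cut after level t (with t + p = M), the words i 0ᵖ j 0ᵖ form a fooling set.
  halvesDistance-cut : ∀ {n M} (A : ABP ℝ (suc n) (M Nat.* 2)) →
                       Monotone ℝ A → Computes ℝ A (halvesDistance M) →
                       ∀ t p → t Nat.+ p ≡ M → suc n Nat.^ t Nat.≤ 2 Nat.^ widthAt t A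
  halvesDistance-cut {n} A mono computes t p refl =
    foolingSet⇒^≤ length mono computes id (λ j → padding ++ (j ++ padding)) diagonal offDiagonal
    where
      M = t Nat.+ p

      padding : Vec (Fin (suc n)) p
      padding = replicate p zero

      length : t Nat.+ (p Nat.+ M) ≡ M Nat.* 2
      length = regroup-length t p
        where
          regroup-length : ∀ t p → t Nat.+ (p Nat.+ (t Nat.+ p)) ≡ (t Nat.+ p) Nat.* 2
          regroup-length = solve-∀

      glue : Vec (Fin (suc n)) t → Vec (Fin (suc n)) t → Vec (Fin (suc n)) (M Nat.* 2)
      glue i j = subst (Vec (Fin (suc n))) length (i ++ (padding ++ (j ++ padding)))

      f-glue : ∀ i j → halvesDistance M (glue i j) ≡ halvesDistance M ((i ++ padding) ++ (j ++ padding))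
      f-glue i j = halvesDistance-cong M (glue i j) ((i ++ padding) ++ (j ++ padding)) λ a →
        trans (valueAt-subst length a letter (i ++ (padding ++ (j ++ padding))))
              (valueAt-++-assoc a letter i padding (j ++ padding))

      diagonal : ∀ i → halvesDistance M (glue i i) ≡ 0#
      diagonal i = trans (f-glue i i) (halvesDistance-++-self (i ++ padding))

      offDiagonal : ∀ i j → i ≢ j → 0# < halvesDistance M (glue i j)
      offDiagonal i j i≢j =
        subst (0# <_) (sym (f-glue i j)) (halvesDistance-++-pos (i≢j ∘ Vecₚ.++-injectiveˡ i j))

  halvesDistance-lowerBound : ∀ {n} M (A : ABP ℝ (suc n) (M Nat.* 2)) →
                              Monotone ℝ A → Computes ℝ A (halvesDistance M) →
                              suc n Nat.^ ((M Nat.* 2) Nat.* (M Nat.* 2)) Nat.≤ 2 Nat.^ (8 Nat.* size ℝ A)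
  halvesDistance-lowerBound {n} M A mono computes = begin
      suc n Nat.^ (D Nat.* D)          ≤⟨ levelBounds⇒^≤ (suc n) M W cut ⟩
      2 Nat.^ (8 Nat.* sumUpTo M W)    ≤⟨ ℕₚ.^-monoʳ-≤ 2 (ℕₚ.*-monoʳ-≤ 8 (sumUpTo-mono-≤ W M≤D)) ⟩
      2 Nat.^ (8 Nat.* sumUpTo D W)    ≡⟨ cong (λ s → 2 Nat.^ (8 Nat.* s)) (sizeL≡sumUpTo-widthAt A) ⟨
      2 Nat.^ (8 Nat.* size ℝ A)       ∎
    where
      open ℕₚ.≤-Reasoning
      D = M Nat.* 2
      M≤D = ℕₚ.m≤m*n M 2
      W = λ t → widthAt t A
      cut : ∀ t → t Nat.≤ M → suc n Nat.^ t Nat.≤ 2 Nat.^ W t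
      cut t t≤M = let p , t+p≡M = ℕₚ.m≤n⇒∃[o]m+o≡n t≤M
                  in  halvesDistance-cut A mono computes t p t+p≡M

  squareChains : ∀ {n} M → Fin M × Fin 4 → ℕ → LinForm ℝ n
  squareChains M (a , c) = binomialChains (toℕ a) letter (M Nat.+ toℕ a) (-_ ∘ letter) c

  halvesDistanceChains : ∀ {n} M → Fin (M Nat.* 4) → ℕ → LinForm ℝ n
  halvesDistanceChains M = squareChains M ∘ remQuot {M} 4

  halvesDistance≡∑wordProduct : ∀ {n} M (w : Vec (Fin n) (M Nat.* 2)) →
                                halvesDistance M w ≡ ∑ (λ r → wordProduct (halvesDistanceChains M r) w)
  halvesDistance≡∑wordProduct M w = sym (begin
      ∑ (λ r → wordProduct (halvesDistanceChains M r) w)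
    ≡⟨ ∑-combine M _ ⟩
      ∑ (λ (a : Fin M) → ∑ (λ (c : Fin 4) → wordProduct (halvesDistanceChains M (combine a c)) w))
    ≡⟨ ∑-cong (λ a → ∑-cong (λ c → cong (λ ac → wordProduct (squareChains M ac) w)
                                        (Finₚ.remQuot-combine a c))) ⟩
      ∑ (λ (a : Fin M) → ∑ (λ (c : Fin 4) → wordProduct (squareChains M (a , c)) w))
    ≡⟨ ∑-cong (λ (a : Fin M) → ∑-binomialChains (toℕ a) letter (M Nat.+ toℕ a) (-_ ∘ letter) w) ⟩
      ∑ (λ (a : Fin M) → (valueAt (toℕ a) letter w + valueAt (M Nat.+ toℕ a) (-_ ∘ letter) w) ²)
    ≡⟨ ∑-cong (λ (a : Fin M) → cong (λ y → (valueAt (toℕ a) letter w + y) ²)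
                                    (valueAt-∘- letter w (M+a<M*2 a))) ⟩
      halvesDistance M w
    ∎)
    where
      open ≡-Reasoning
      double : ∀ M → M Nat.+ M ≡ M Nat.* 2
      double = solve-∀
      M+a<M*2 : ∀ (a : Fin M) → M Nat.+ toℕ a Nat.< M Nat.* 2
      M+a<M*2 a = subst (M Nat.+ toℕ a Nat.<_) (double M) (ℕₚ.+-monoʳ-< M (Finₚ.toℕ<n a))

  halvesDistance-upperBound : ∀ {n} m → ∃ λ (A : ABP ℝ n (suc m Nat.* 2)) →
                              Computes ℝ A (halvesDistance (suc m))
                              × size ℝ A Nat.≤ 2 Nat.* ((suc m Nat.* 2) Nat.* (suc m Nat.* 2))
  halvesDistance-upperBound m =
      sumOfProducts k h
    , (λ w → trans (sumOfProducts-computes k h w) (sym (halvesDistance≡∑wordProduct (suc m) w)))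
    , subst (Nat._≤ bound) (sym (sumOfProducts-size k h))
            (ℕₚ.m+n≤o⇒m≤o _ (ℕₚ.≤-reflexive (size-slack m)))
    where
      k = m Nat.* 2
      h = halvesDistanceChains (suc m)
      bound = 2 Nat.* ((suc m Nat.* 2) Nat.* (suc m Nat.* 2))
      size-slack : ∀ m → suc (suc (m Nat.* 2) Nat.* (suc m Nat.* 4) Nat.+ 1) Nat.+ (4 Nat.* m Nat.+ 2)
                         ≡ 2 Nat.* ((suc m Nat.* 2) Nat.* (suc m Nat.* 2))
      size-slack = solve-∀

open Nat using (_≤_; _*_; _^_)

theorem1 : (ℝ : RealField) →
    ∃ λ (K : ℕ) → NonZero K × ∃ λ (C : ℕ) →
      ∀ (n d : ℕ) → 2 ≤ n → 2 ≤ d → 2 ∣ d →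
        ∃ λ (f : Poly ℝ n d) →
          (∀ w → RealField._≤_ ℝ (RealField.0# ℝ) (f w))
          × (∀ (A : ABP ℝ n d) → Monotone ℝ A → Computes ℝ A f →
               n ^ (d * d) ≤ 2 ^ (K * size ℝ A))
          × (∃ λ (A : ABP ℝ n d) → Computes ℝ A f × size ℝ A ≤ C * (d * d))
theorem1 ℝ = 8 , _ , 2 , λ where
  zero    _              ()  _  _
  (suc n) .(zero * 2)    _   () (divides zero refl)
  (suc n) .(suc m * 2)   _   _  (divides (suc m) refl) →
      halvesDistance ℝ (suc m)
    , halvesDistance-nonneg ℝ (suc m)
    , halvesDistance-lowerBound ℝ (suc m)
    , halvesDistance-upperBound ℝ m
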